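{- Let $\mathcal{C}$ be a class of propositional formulas (in negation normal form) that is closed under subformulas and complementation, and let $\mathcal{C}'$ be the closure of $\mathcal{C}$ under disjunctions. Let $A_1,\dots,A_m$ and $A$ be formulas in $\mathcal{C}'$. If $A_1,\dots,A_m$ logically imply $A$, then there is a $\mathcal{C}'$-Frege proof of $A$ from $A_1,\dots,A_m$. Moreover, if the formulas $A_1,\dots,A_m,A$ have $n$ variables and size at most $s$, then the size of the proof is at most polynomial in $n$, $s$, $m$, $2^n$ and $s^m$.
   Context: Formulas are built from literals $X,\overline{X}$ with $\wedge,\vee$ (considered commutative, associative and idempotent) and the constants $0$ (empty formula, false) and $1$ (true), with $0\vee A=A$, $1\wedge A=A$, $0\wedge A=0$, $1\vee A=1$. The complement $\overline{A}$ is defined by De Morgan: $\overline{\overline X}=X$, $\overline{C\wedge D}=\overline C\vee\overline D$, $\overline{C\vee D}=\overline C\wedge\overline D$. Size: $s(0)=s(1)=0$, $s(\text{literal})=1$, $s(C\circ D)=s(C)+s(D)+1$. Frege has the rules: axiom $A\vee\overline A$; cut: from $C\vee A$ and $D\vee\overline A$ infer $C\vee D$; introduction of conjunction: from $C\vee A$ and $D\vee B$ infer $C\vee D\vee(A\wedge B)$; weakening: from $C$ infer $C\vee D$ ($C,D$ may be $0$ or $1$). A Frege proof from $F$ may use formulas of $F$ as additional axioms. A $\mathcal{C}'$-Frege proof is one all of whose formulas are in $\mathcal{C}'$. The size of a proof is the sum of the sizes of its formulas. -}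

module Defs where

open import Data.Nat using (ℕ; zero; suc; _+_; _*_; _^_; _≤_)
open import Data.Fin using (Fin)
open import Data.Bool using (Bool; true; false; not; _∧_; _∨_)
open import Data.List using (List; []; _∷_; length)
open import Data.List.Relation.Unary.All using (All)
open import Data.List.Membership.Propositional using (_∈_)
open import Data.Product using (Σ; _×_; _,_)

data Formula (n : ℕ) : Set where
  pos  : Fin n → Formula n
  neg  : Fin n → Formula n
  𝟘    : Formula n
  𝟙    : Formula n
  _⋀_  : Formula n → Formula n → Formula n
  _⋁_  : Formula n → Formula n → Formula n

infixr 6 _⋀_
infixr 5 _⋁_

comp : ∀ {n} → Formula n → Formula n
comp (pos x) = neg x
comp (neg x) = pos x
comp 𝟘 = 𝟙
comp 𝟙 = 𝟘
comp (C ⋀ D) = comp C ⋁ comp D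
comp (C ⋁ D) = comp C ⋀ comp D

size : ∀ {n} → Formula n → ℕ
size (pos _) = 1
size (neg _) = 1
size 𝟘 = 0
size 𝟙 = 0
size (C ⋀ D) = size C + size D + 1
size (C ⋁ D) = size C + size D + 1

eval : ∀ {n} → (Fin n → Bool) → Formula n → Bool
eval ρ (pos x) = ρ x
eval ρ (neg x) = not (ρ x)
eval ρ 𝟘 = false
eval ρ 𝟙 = true
eval ρ (C ⋀ D) = eval ρ C ∧ eval ρ D
eval ρ (C ⋁ D) = eval ρ C ∨ eval ρ D

Implies : ∀ {n} → List (Formula n) → Formula n → Set
Implies {n} As A = (ρ : Fin n → Bool) → All (λ B → eval ρ B ≡ᵇ true) As → eval ρ A ≡ᵇ true
  where
  open import Relation.Binary.PropositionalEquality renaming (_≡_ to _≡ᵇ_)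

infix 4 _≈_
data _≈_ {n : ℕ} : Formula n → Formula n → Set where
  ≈-refl  : ∀ {A} → A ≈ A
  ≈-sym   : ∀ {A B} → A ≈ B → B ≈ A
  ≈-trans : ∀ {A B C} → A ≈ B → B ≈ C → A ≈ C
  ⋀-cong  : ∀ {A A′ B B′} → A ≈ A′ → B ≈ B′ → (A ⋀ B) ≈ (A′ ⋀ B′)
  ⋁-cong  : ∀ {A A′ B B′} → A ≈ A′ → B ≈ B′ → (A ⋁ B) ≈ (A′ ⋁ B′)
  ⋀-comm  : ∀ {A B} → (A ⋀ B) ≈ (B ⋀ A)
  ⋁-comm  : ∀ {A B} → (A ⋁ B) ≈ (B ⋁ A)
  ⋀-assoc : ∀ {A B C} → ((A ⋀ B) ⋀ C) ≈ (A ⋀ (B ⋀ C))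
  ⋁-assoc : ∀ {A B C} → ((A ⋁ B) ⋁ C) ≈ (A ⋁ (B ⋁ C))
  ⋀-idem  : ∀ {A} → (A ⋀ A) ≈ A
  ⋁-idem  : ∀ {A} → (A ⋁ A) ≈ A
  𝟘⋁      : ∀ {A} → (𝟘 ⋁ A) ≈ A
  𝟙⋀      : ∀ {A} → (𝟙 ⋀ A) ≈ A
  𝟘⋀      : ∀ {A} → (𝟘 ⋀ A) ≈ 𝟘
  𝟙⋁      : ∀ {A} → (𝟙 ⋁ A) ≈ 𝟙

SubformulaClosed : ∀ {n} → (Formula n → Set) → Set
SubformulaClosed {n} 𝒞 =
  (∀ (C D : Formula n) → 𝒞 (C ⋀ D) → 𝒞 C × 𝒞 D) ×
  (∀ (C D : Formula n) → 𝒞 (C ⋁ D) → 𝒞 C × 𝒞 D)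

ComplementClosed : ∀ {n} → (Formula n → Set) → Set
ComplementClosed {n} 𝒞 = ∀ (A : Formula n) → 𝒞 A → 𝒞 (comp A)

data DisjClosure {n : ℕ} (𝒞 : Formula n → Set) : Formula n → Set where
  base  : ∀ {A} → 𝒞 A → DisjClosure 𝒞 A
  empty : DisjClosure 𝒞 𝟘
  disj  : ∀ {A B} → DisjClosure 𝒞 A → DisjClosure 𝒞 B → DisjClosure 𝒞 (A ⋁ B)

_∈≈_ : ∀ {n} → Formula n → List (Formula n) → Set
F ∈≈ ls = Σ _ (λ G → (G ∈ ls) × (G ≈ F))

data Step {n : ℕ} (Hyp : List (Formula n)) (prev : List (Formula n)) (F : Formula n) : Set where
  axiom : ∀ A → F ≈ (A ⋁ comp A) → Step Hyp prev F
  hyp   : F ∈ Hyp → Step Hyp prev F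
  cut   : ∀ C D A → (C ⋁ A) ∈≈ prev → (D ⋁ comp A) ∈≈ prev → F ≈ (C ⋁ D) → Step Hyp prev F
  ∧-intro : ∀ C D A B → (C ⋁ A) ∈≈ prev → (D ⋁ B) ∈≈ prev →
            F ≈ (C ⋁ D ⋁ (A ⋀ B)) → Step Hyp prev F
  weaken : ∀ C D → C ∈≈ prev → F ≈ (C ⋁ D) → Step Hyp prev F

-- A Frege proof from Hyp whose lines, most recent first, are the given list.
data Proof {n : ℕ} (Hyp : List (Formula n)) : List (Formula n) → Set where
  []  : Proof Hyp []
  _∷_ : ∀ {F ls} → Step Hyp ls F → Proof Hyp ls → Proof Hyp (F ∷ ls)

proofSize : ∀ {n} → List (Formula n) → ℕ
proofSize [] = 0
proofSize (F ∷ ls) = size F + proofSize ls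

CFregeProof : ∀ {n} → (Formula n → Set) → List (Formula n) → Formula n → ℕ → Set
CFregeProof {n} 𝒞′ Hyp A b =
  Σ (List (Formula n)) (λ ls →
    Proof Hyp (A ∷ ls) × All 𝒞′ (A ∷ ls) × proofSize (A ∷ ls) ≤ b)

-- Let Γρ be the disjunction of the literals falsified by an assignment ρ to the variables
-- occurring in A₁,…,Aₘ,A; these literals lie in 𝒞, so Γρ ∈ 𝒞′. By induction on E ∈ 𝒞 one
-- derives Γρ ∨ E or Γρ ∨ Ē, whichever is true under ρ, in O(|E|) lines. If ρ satisfies A this
-- yields Γρ ∨ A; otherwise some Aᵢ is false under ρ, and cutting its disjuncts one by one out
-- of the weakened hypothesis Γρ ∨ A ∨ Aᵢ again yields Γρ ∨ A. Cutting on the variables one at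
-- a time merges these 2^v clauses into A. Every line has size O(n + s), and there are
-- O(2^n s) lines.
module Submission where

open import Defs
open import Data.Bool using (Bool; true; false; not) renaming (_≟_ to _≟ᵇ_)
open import Data.Bool.Properties using (∨-conicalˡ; ∨-conicalʳ; ¬-not)
open import Data.Fin using (Fin; _≟_)
open import Data.List using (List; []; _∷_; length; _++_; filter; allFin)
open import Data.List.Properties using (length-++; length-filter; length-tabulate)
open import Data.List.Membership.Propositional using (_∈_; find; lose)
open import Data.List.Membership.Propositional.Properties
  using (∈-++⁺ˡ; ∈-++⁺ʳ; ∈-filter⁺; ∈-filter⁻; ∈-allFin)
open import Data.List.Relation.Unary.All as All using (All; []; _∷_; lookupAny)
open import Data.List.Relation.Unary.All.Properties using (++⁺; ¬All⇒Any¬)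
open import Data.List.Relation.Unary.AllPairs using ([]; _∷_)
open import Data.List.Relation.Unary.Any using (Any; here; there; any?)
open import Data.List.Relation.Unary.Unique.Propositional using (Unique)
open import Data.List.Relation.Unary.Unique.Propositional.Properties using (allFin⁺; filter⁺)
open import Data.Nat using (ℕ; suc; _+_; _*_; _^_; _≤_; _<_; z≤n; s≤s)
open import Data.Nat.Properties
  using (≤-refl; ≤-reflexive; ≤-trans; ≤-pred; +-comm; +-suc; *-suc; *-identityˡ; *-distribˡ-+;
         m≤m+n; m≤n+m; n≤1+n; +-mono-≤; +-monoˡ-≤; +-monoʳ-≤; *-mono-≤; *-monoˡ-≤; *-monoʳ-≤;
         ^-monoʳ-≤; module ≤-Reasoning)
open import Data.Nat.Tactic.RingSolver using (solve-∀)
open import Data.Product using (Σ; _×_; _,_; proj₁; proj₂; uncurry)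
open import Data.Sum using (inj₁; inj₂; [_,_])
open import Data.Vec.Functional using (updateAt)
open import Data.Vec.Functional.Properties using (updateAt-updates; updateAt-minimal)
open import Function using (id; const; _∘_)
open import Relation.Nullary using (Dec; no; contradiction)
open import Relation.Unary using (Decidable)
open import Relation.Nullary.Decidable using (map′; _⊎-dec_)
open import Relation.Binary.PropositionalEquality
  using (_≡_; _≢_; refl; sym; trans; cong; cong₂; subst; module ≡-Reasoning)

module _ {n : ℕ} where

  infixr 2 _⟫_
  _⟫_ : {A B C : Formula n} → A ≈ B → B ≈ C → A ≈ C
  _⟫_ = ≈-trans

  ⋁-assoc⁻¹ : {A B C : Formula n} → (A ⋁ (B ⋁ C)) ≈ ((A ⋁ B) ⋁ C)
  ⋁-assoc⁻¹ = ≈-sym ⋁-assoc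

  ⋁-identityʳ : {A : Formula n} → (A ⋁ 𝟘) ≈ A
  ⋁-identityʳ = ⋁-comm ⟫ 𝟘⋁

  ⋁-contract : {A B : Formula n} → (A ⋁ (A ⋁ B)) ≈ (A ⋁ B)
  ⋁-contract = ⋁-assoc⁻¹ ⟫ ⋁-cong ⋁-idem ≈-refl

  ⋁-leftComm : {A B C : Formula n} → (A ⋁ (B ⋁ C)) ≈ (B ⋁ (A ⋁ C))
  ⋁-leftComm = ⋁-assoc⁻¹ ⟫ ⋁-cong ⋁-comm ≈-refl ⟫ ⋁-assoc

  ⋁-rotate : {A B C : Formula n} → (A ⋁ (B ⋁ C)) ≈ ((A ⋁ C) ⋁ B)
  ⋁-rotate = ⋁-cong ≈-refl ⋁-comm ⟫ ⋁-assoc⁻¹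

  ⋁-absorbs-absorbed : {A B C : Formula n} → A ≈ (A ⋁ C) → (A ⋁ B) ≈ ((A ⋁ B) ⋁ C)
  ⋁-absorbs-absorbed A≈A⋁C = ⋁-cong A≈A⋁C ≈-refl ⟫ ⋁-assoc ⟫ ⋁-rotate

module _ {n : ℕ} {Hyp : List (Formula n)} where

  ∈≈-++⁺ˡ : ∀ {F : Formula n} {xs} ys → F ∈≈ xs → F ∈≈ (xs ++ ys)
  ∈≈-++⁺ˡ ys (G , G∈ , G≈F) = G , ∈-++⁺ˡ G∈ , G≈F

  Step-++⁺ : ∀ {xs F} ys → Step Hyp xs F → Step Hyp (xs ++ ys) F
  Step-++⁺ ys (axiom A e) = axiom A e
  Step-++⁺ ys (hyp F∈) = hyp F∈
  Step-++⁺ ys (cut C D A p q e) = cut C D A (∈≈-++⁺ˡ ys p) (∈≈-++⁺ˡ ys q) e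
  Step-++⁺ ys (∧-intro C D A B p q e) = ∧-intro C D A B (∈≈-++⁺ˡ ys p) (∈≈-++⁺ˡ ys q) e
  Step-++⁺ ys (weaken C D p e) = weaken C D (∈≈-++⁺ˡ ys p) e

  Proof-++ : ∀ {xs ys} → Proof Hyp xs → Proof Hyp ys → Proof Hyp (xs ++ ys)
  Proof-++ [] q = q
  Proof-++ {ys = ys} (st ∷ p) q = Step-++⁺ ys st ∷ Proof-++ p q

proofSize≤ : ∀ {n L} (xs : List (Formula n)) → All (λ G → size G ≤ L) xs → proofSize xs ≤ length xs * L
proofSize≤ [] [] = z≤n
proofSize≤ (x ∷ xs) (x≤ ∷ xs≤) = +-mono-≤ x≤ (proofSize≤ xs xs≤)

suc-+-< : ∀ {a b j k} → a < j → b < k → suc (a + b) < j + k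
suc-+-< {a} {b} a<j b<k = ≤-trans (s≤s (≤-reflexive (sym (+-suc a b)))) (+-mono-≤ a<j b<k)

Admissible : ∀ {n} → (Formula n → Set) → ℕ → Formula n → Set
Admissible 𝒞′ L F = 𝒞′ F × size F ≤ L

module Derivations {n : ℕ} (Line : Formula n → Set) (Hyp : List (Formula n)) where

  -- The bound on the number of lines is strict, so that the bounds of two
  -- derivations combined by a binary rule simply add up.
  record Derivation (F : Formula n) (k : ℕ) : Set where
    constructor derivation
    field
      earlier  : List (Formula n)
      proof    : Proof Hyp (F ∷ earlier)
      admitted : All Line (F ∷ earlier)
      length<  : length (F ∷ earlier) < k

  Derivation-mono : ∀ {F j k} → j ≤ k → Derivation F j → Derivation F k
  Derivation-mono j≤k (derivation ls p a l) = derivation ls p a (≤-trans l j≤k)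

  axiomᵈ : ∀ {F} X → F ≈ (X ⋁ comp X) → Line F → Derivation F 2
  axiomᵈ X e lF = derivation [] (axiom X e ∷ []) (lF ∷ []) ≤-refl

  hypᵈ : ∀ {F} → F ∈ Hyp → Line F → Derivation F 2
  hypᵈ F∈ lF = derivation [] (hyp F∈ ∷ []) (lF ∷ []) ≤-refl

  weakenᵈ : ∀ {F C k} D → F ≈ (C ⋁ D) → Derivation C k → Line F → Derivation F (suc k)
  weakenᵈ {C = C} D e (derivation ls p a l) lF =
    derivation (C ∷ ls) (weaken C D (C , here refl , ≈-refl) e ∷ p) (lF ∷ a) (s≤s l)

  private
    combine : ∀ {F F₁ F₂ j k} → (∀ {ls} → F₁ ∈ ls → F₂ ∈ ls → Step Hyp ls F) →
              Derivation F₁ j → Derivation F₂ k → Line F → Derivation F (j + k)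
    combine {F₁ = F₁} {F₂} {j} {k} step (derivation ls₁ p₁ a₁ l₁) (derivation ls₂ p₂ a₂ l₂) lF =
      derivation ((F₁ ∷ ls₁) ++ (F₂ ∷ ls₂))
        (step (here refl) (∈-++⁺ʳ (F₁ ∷ ls₁) (here refl)) ∷ Proof-++ p₁ p₂)
        (lF ∷ ++⁺ a₁ a₂)
        (subst (λ m → suc m < j + k) (sym (length-++ (F₁ ∷ ls₁))) (suc-+-< l₁ l₂))

  cutᵈ : ∀ {F F₁ F₂ j k} C D X → F₁ ≈ (C ⋁ X) → F₂ ≈ (D ⋁ comp X) → F ≈ (C ⋁ D) →
         Derivation F₁ j → Derivation F₂ k → Line F → Derivation F (j + k)
  cutᵈ {F₁ = F₁} {F₂} C D X e₁ e₂ e =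
    combine λ F₁∈ F₂∈ → cut C D X (F₁ , F₁∈ , e₁) (F₂ , F₂∈ , e₂) e

  ∧-introᵈ : ∀ {F F₁ F₂ j k} C D X Y → F₁ ≈ (C ⋁ X) → F₂ ≈ (D ⋁ Y) → F ≈ (C ⋁ D ⋁ (X ⋀ Y)) →
             Derivation F₁ j → Derivation F₂ k → Line F → Derivation F (j + k)
  ∧-introᵈ {F₁ = F₁} {F₂} C D X Y e₁ e₂ e =
    combine λ F₁∈ F₂∈ → ∧-intro C D X Y (F₁ , F₁∈ , e₁) (F₂ , F₂∈ , e₂) e

  extendʳᵈ : ∀ {C F G k} → Derivation (C ⋁ F) k → Line (C ⋁ (F ⋁ G)) → Derivation (C ⋁ (F ⋁ G)) (suc k)
  extendʳᵈ {G = G} = weakenᵈ G ⋁-assoc⁻¹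

  extendˡᵈ : ∀ {C F G k} → Derivation (C ⋁ G) k → Line (C ⋁ (F ⋁ G)) → Derivation (C ⋁ (F ⋁ G)) (suc k)
  extendˡᵈ {F = F} = weakenᵈ F ⋁-rotate

  conjoinᵈ : ∀ {C F G j k} → Derivation (C ⋁ F) j → Derivation (C ⋁ G) k →
             Line (C ⋁ (F ⋀ G)) → Derivation (C ⋁ (F ⋀ G)) (j + k)
  conjoinᵈ {C} {F} {G} = ∧-introᵈ C C F G ≈-refl ≈-refl (≈-sym ⋁-contract)

  resolveᵈ : ∀ {C X F₁ F₂ j k} → F₁ ≈ (C ⋁ X) → F₂ ≈ (C ⋁ comp X) →
             Derivation F₁ j → Derivation F₂ k → Line C → Derivation C (j + k)
  resolveᵈ {C} {X} e₁ e₂ = cutᵈ C C X e₁ e₂ (≈-sym ⋁-idem)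

module _ {n : ℕ} where

  infix 4 _occursIn_
  data _occursIn_ (x : Fin n) : Formula n → Set where
    lit⁺ : x occursIn pos x
    lit⁻ : x occursIn neg x
    ⋀ˡ   : ∀ {F G} → x occursIn F → x occursIn (F ⋀ G)
    ⋀ʳ   : ∀ {F G} → x occursIn G → x occursIn (F ⋀ G)
    ⋁ˡ   : ∀ {F G} → x occursIn F → x occursIn (F ⋁ G)
    ⋁ʳ   : ∀ {F G} → x occursIn G → x occursIn (F ⋁ G)

  occurs? : ∀ x E → Dec (x occursIn E)
  occurs? x (pos y) = map′ (λ { refl → lit⁺ }) (λ { lit⁺ → refl }) (x ≟ y)
  occurs? x (neg y) = map′ (λ { refl → lit⁻ }) (λ { lit⁻ → refl }) (x ≟ y)
  occurs? x 𝟘 = no λ ()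
  occurs? x 𝟙 = no λ ()
  occurs? x (F ⋀ G) =
    map′ [ ⋀ˡ , ⋀ʳ ] (λ { (⋀ˡ o) → inj₁ o ; (⋀ʳ o) → inj₂ o }) (occurs? x F ⊎-dec occurs? x G)
  occurs? x (F ⋁ G) =
    map′ [ ⋁ˡ , ⋁ʳ ] (λ { (⋁ˡ o) → inj₁ o ; (⋁ʳ o) → inj₂ o }) (occurs? x F ⊎-dec occurs? x G)

  VarsIn : List (Fin n) → Formula n → Set
  VarsIn us E = ∀ {x} → x occursIn E → x ∈ us

  record LiteralsIn (𝒞 : Formula n → Set) (x : Fin n) : Set where
    constructor literals
    field
      pos∈ : 𝒞 (pos x)
      neg∈ : 𝒞 (neg x)

  module _ {𝒞 : Formula n → Set} (sc : SubformulaClosed 𝒞) (cc : ComplementClosed 𝒞) where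

    occurs⇒literalsIn : ∀ {x E} → 𝒞 E → x occursIn E → LiteralsIn 𝒞 x
    occurs⇒literalsIn c lit⁺ = literals c (cc _ c)
    occurs⇒literalsIn c lit⁻ = literals (cc _ c) c
    occurs⇒literalsIn {E = F ⋀ G} c (⋀ˡ o) = occurs⇒literalsIn (proj₁ (proj₁ sc F G c)) o
    occurs⇒literalsIn {E = F ⋀ G} c (⋀ʳ o) = occurs⇒literalsIn (proj₂ (proj₁ sc F G c)) o
    occurs⇒literalsIn {E = F ⋁ G} c (⋁ˡ o) = occurs⇒literalsIn (proj₁ (proj₂ sc F G c)) o
    occurs⇒literalsIn {E = F ⋁ G} c (⋁ʳ o) = occurs⇒literalsIn (proj₂ (proj₂ sc F G c)) o

    occurs⇒literalsIn′ : ∀ {x E} → DisjClosure 𝒞 E → x occursIn E → LiteralsIn 𝒞 x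
    occurs⇒literalsIn′ (base c) o = occurs⇒literalsIn c o
    occurs⇒literalsIn′ (disj d _) (⋁ˡ o) = occurs⇒literalsIn′ d o
    occurs⇒literalsIn′ (disj _ d) (⋁ʳ o) = occurs⇒literalsIn′ d o

  size-comp : (E : Formula n) → size (comp E) ≡ size E
  size-comp (pos x) = refl
  size-comp (neg x) = refl
  size-comp 𝟘 = refl
  size-comp 𝟙 = refl
  size-comp (F ⋀ G) = cong₂ (λ a b → a + b + 1) (size-comp F) (size-comp G)
  size-comp (F ⋁ G) = cong₂ (λ a b → a + b + 1) (size-comp F) (size-comp G)

  sizeˡ : ∀ (F G : Formula n) → size F ≤ size F + size G + 1
  sizeˡ F G = ≤-trans (m≤m+n (size F) (size G)) (m≤m+n _ 1)

  sizeʳ : ∀ (F G : Formula n) → size G ≤ size F + size G + 1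
  sizeʳ F G = ≤-trans (m≤n+m (size G) (size F)) (m≤m+n _ 1)

  -- signed (eval ρ E) E is whichever of E and its complement is true under ρ.
  signed : Bool → Formula n → Formula n
  signed true E = E
  signed false E = comp E

  signed-closed : ∀ {𝒞 : Formula n → Set} → ComplementClosed 𝒞 → ∀ b {E} → 𝒞 E → 𝒞 (signed b E)
  signed-closed cc true c = c
  signed-closed cc false c = cc _ c

  size-signed : ∀ b (E : Formula n) → size (signed b E) ≡ size E
  size-signed true E = refl
  size-signed false E = size-comp E

  signed-not-neg : ∀ b x → signed (not b) (neg x) ≡ signed b (pos x)
  signed-not-neg true x = refl
  signed-not-neg false x = refl

  satisfied : (Fin n → Bool) → Fin n → Formula n
  satisfied ρ x = signed (ρ x) (pos x)

  clause : (Fin n → Bool) → List (Fin n) → Formula n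
  clause ρ [] = 𝟘
  clause ρ (x ∷ us) = comp (satisfied ρ x) ⋁ clause ρ us

  clause-absorbs : ∀ {ρ x us} → x ∈ us → clause ρ us ≈ (comp (satisfied ρ x) ⋁ clause ρ us)
  clause-absorbs (here refl) = ≈-sym ⋁-contract
  clause-absorbs (there x∈) = ⋁-cong ≈-refl (clause-absorbs x∈) ⟫ ⋁-leftComm

  size-clause : ∀ ρ us → size (clause ρ us) ≡ 2 * length us
  size-clause ρ [] = refl
  size-clause ρ (x ∷ us) = begin
      size (comp (satisfied ρ x)) + size (clause ρ us) + 1
    ≡⟨ cong₂ (λ a b → a + b + 1) (trans (size-comp (satisfied ρ x)) (size-signed (ρ x) (pos x))) (size-clause ρ us) ⟩
      1 + 2 * length us + 1
    ≡⟨ double-suc (length us) ⟩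
      2 * suc (length us)
    ∎
    where
    open ≡-Reasoning
    double-suc : ∀ m → 1 + 2 * m + 1 ≡ 2 * suc m
    double-suc = solve-∀

  module _ {𝒞 : Formula n → Set} {x : Fin n} (lits : LiteralsIn 𝒞 x) where
    open LiteralsIn lits

    satisfied-closed : ∀ b → 𝒞 (signed b (pos x))
    satisfied-closed true = pos∈
    satisfied-closed false = neg∈

    falsified-closed : ∀ b → 𝒞 (comp (signed b (pos x)))
    falsified-closed true = neg∈
    falsified-closed false = pos∈

  clause-closed : ∀ {𝒞 : Formula n → Set} ρ {us} → All (LiteralsIn 𝒞) us → DisjClosure 𝒞 (clause ρ us)
  clause-closed ρ [] = empty
  clause-closed ρ {x ∷ _} (lits ∷ us-lits) =
    disj (base (falsified-closed lits (ρ x))) (clause-closed ρ us-lits)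

  clause-updateAt-other : ∀ ρ x f us → All (x ≢_) us → clause (updateAt ρ x f) us ≡ clause ρ us
  clause-updateAt-other ρ x f [] [] = refl
  clause-updateAt-other ρ x f (y ∷ us) (x≢y ∷ x∉us) =
    cong₂ (λ b C → comp (signed b (pos y)) ⋁ C)
      (updateAt-minimal y x ρ (x≢y ∘ sym)) (clause-updateAt-other ρ x f us x∉us)

  clause-updateAt : ∀ ρ x b us → All (x ≢_) us →
                    clause (updateAt ρ x (const b)) (x ∷ us) ≡ (comp (signed b (pos x)) ⋁ clause ρ us)
  clause-updateAt ρ x b us x∉us =
    cong₂ (λ b C → comp (signed b (pos x)) ⋁ C) (updateAt-updates x ρ) (clause-updateAt-other ρ x _ us x∉us)

module _ {n : ℕ} {𝒞′ : Formula n → Set} {Hyp : List (Formula n)} {L : ℕ} where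
  open Derivations (Admissible 𝒞′ L) Hyp

  Derivation⇒CFregeProof : ∀ {F k b} → Derivation F (suc k) → k * L ≤ b → CFregeProof 𝒞′ Hyp F b
  Derivation⇒CFregeProof {F} (derivation ls p a l) kL≤b =
    ls , p , All.map proj₁ a ,
    ≤-trans (proofSize≤ (F ∷ ls) (All.map proj₂ a)) (≤-trans (*-monoˡ-≤ L (≤-pred l)) kL≤b)

count-both : ∀ a b → (2 * a + 2) + (2 * b + 2) ≡ 2 * (a + b + 1) + 2
count-both = solve-∀

count-left : ∀ a b → suc (2 * a + 2) ≤ 2 * (a + b + 1) + 2
count-left a b = ≤-trans (m≤m+n (suc (2 * a + 2)) (2 * b + 1)) (≤-reflexive (shift a b))
  where
  shift : ∀ a b → suc (2 * a + 2) + (2 * b + 1) ≡ 2 * (a + b + 1) + 2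
  shift = solve-∀

count-right : ∀ a b → suc (2 * b + 2) ≤ 2 * (a + b + 1) + 2
count-right a b = subst (suc (2 * b + 2) ≤_) (cong (λ m → 2 * (m + 1) + 2) (+-comm b a)) (count-left b a)

count-discharge : ∀ k a b → k + (2 * a + 2) + (2 * b + 2) ≡ k + (2 * (a + b + 1) + 2)
count-discharge = solve-∀

module Evaluation {n : ℕ} {𝒞 : Formula n → Set} (sc : SubformulaClosed 𝒞) (cc : ComplementClosed 𝒞)
  (Hyp : List (Formula n)) (L s : ℕ) (3≤L : 3 ≤ L)
  (ρ : Fin n → Bool) (us : List (Fin n)) (us-literals : All (LiteralsIn 𝒞) us)
  (room : size (clause ρ us) + 2 * s + 2 ≤ L) where

  open Derivations (Admissible (DisjClosure 𝒞) L) Hyp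

  private
    Γ : Formula n
    Γ = clause ρ us

    Γ-closed : DisjClosure 𝒞 Γ
    Γ-closed = clause-closed ρ us-literals

    room′ : size Γ + s + 1 ≤ L
    room′ = ≤-trans (m≤m+n (size Γ + s + 1) (s + 1)) (≤-trans (≤-reflexive (regroup (size Γ) s)) room)
      where
      regroup : ∀ g s → g + s + 1 + (s + 1) ≡ g + 2 * s + 2
      regroup = solve-∀

  clause-line : ∀ {X} → DisjClosure 𝒞 X → size X ≤ s → Admissible (DisjClosure 𝒞) L (Γ ⋁ X)
  clause-line d sX = disj Γ-closed d , ≤-trans (+-monoˡ-≤ 1 (+-monoʳ-≤ (size Γ) sX)) room′

  signed-line : ∀ b {E} → 𝒞 E → size E ≤ s → Admissible (DisjClosure 𝒞) L (Γ ⋁ signed b E)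
  signed-line b {E} c sE = clause-line (base (signed-closed cc b c)) (≤-trans (≤-reflexive (size-signed b E)) sE)

  literalᵈ : ∀ {x} → x ∈ us → 1 ≤ s → Derivation (Γ ⋁ satisfied ρ x) 3
  literalᵈ {x} x∈us 1≤s =
    weakenᵈ Γ (⋁-cong (clause-absorbs x∈us) ≈-refl ⟫ ⋁-comm ⟫ ⋁-assoc⁻¹)
      (axiomᵈ ℓ ≈-refl (disj (base (satisfied-closed lits (ρ x))) (base (falsified-closed lits (ρ x))) , axiom-size))
      (clause-line (base (satisfied-closed lits (ρ x))) (≤-trans (≤-reflexive ℓ-size) 1≤s))
    where
    ℓ : Formula n
    ℓ = satisfied ρ x
    lits : LiteralsIn 𝒞 x
    lits = All.lookup us-literals x∈us
    ℓ-size : size ℓ ≡ 1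
    ℓ-size = size-signed (ρ x) (pos x)
    axiom-size : size (ℓ ⋁ comp ℓ) ≤ L
    axiom-size = subst (_≤ L) (sym (cong₂ (λ a b → a + b + 1) ℓ-size (trans (size-comp ℓ) ℓ-size))) 3≤L

  evaluateᵈ : ∀ E → 𝒞 E → size E ≤ s → VarsIn us E → Derivation (Γ ⋁ signed (eval ρ E) E) (2 * size E + 2)
  evaluateᵈ (pos x) _ sE vs = Derivation-mono (n≤1+n 3) (literalᵈ (vs lit⁺) sE)
  evaluateᵈ (neg x) _ sE vs =
    subst (λ ℓ → Derivation (Γ ⋁ ℓ) 4) (sym (signed-not-neg (ρ x) x))
      (Derivation-mono (n≤1+n 3) (literalᵈ (vs lit⁻) sE))
  evaluateᵈ 𝟘 c _ _ = axiomᵈ 𝟙 (⋁-comm ⟫ 𝟙⋁ ⟫ ≈-sym 𝟙⋁) (signed-line false c z≤n)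
  evaluateᵈ 𝟙 c _ _ = axiomᵈ 𝟙 (⋁-comm ⟫ 𝟙⋁ ⟫ ≈-sym 𝟙⋁) (signed-line true c z≤n)
  evaluateᵈ (F ⋀ G) c sE vs
    with eval ρ F | eval ρ G
       | evaluateᵈ F (proj₁ (proj₁ sc F G c)) (≤-trans (sizeˡ F G) sE) (vs ∘ ⋀ˡ)
       | evaluateᵈ G (proj₂ (proj₁ sc F G c)) (≤-trans (sizeʳ F G) sE) (vs ∘ ⋀ʳ)
  ... | true  | true  | dF | dG =
    Derivation-mono (≤-reflexive (count-both (size F) (size G))) (conjoinᵈ dF dG (signed-line true c sE))
  ... | false | _     | dF | _  =
    Derivation-mono (count-left (size F) (size G)) (extendʳᵈ dF (signed-line false c sE))
  ... | true  | false | _  | dG =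
    Derivation-mono (count-right (size F) (size G)) (extendˡᵈ dG (signed-line false c sE))
  evaluateᵈ (F ⋁ G) c sE vs
    with eval ρ F | eval ρ G
       | evaluateᵈ F (proj₁ (proj₂ sc F G c)) (≤-trans (sizeˡ F G) sE) (vs ∘ ⋁ˡ)
       | evaluateᵈ G (proj₂ (proj₂ sc F G c)) (≤-trans (sizeʳ F G) sE) (vs ∘ ⋁ʳ)
  ... | false | false | dF | dG =
    Derivation-mono (≤-reflexive (count-both (size F) (size G))) (conjoinᵈ dF dG (signed-line false c sE))
  ... | true  | _     | dF | _  =
    Derivation-mono (count-left (size F) (size G)) (extendʳᵈ dF (signed-line true c sE))
  ... | false | true  | _  | dG =
    Derivation-mono (count-right (size F) (size G)) (extendˡᵈ dG (signed-line true c sE))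

  true-disjunctionᵈ : ∀ {D} → DisjClosure 𝒞 D → size D ≤ s → VarsIn us D → eval ρ D ≡ true →
                      Derivation (Γ ⋁ D) (2 * size D + 2)
  true-disjunctionᵈ {D} (base c) sD vs e =
    subst (λ b → Derivation (Γ ⋁ signed b D) (2 * size D + 2)) e (evaluateᵈ D c sD vs)
  true-disjunctionᵈ empty _ _ ()
  true-disjunctionᵈ {D₁ ⋁ D₂} (disj d₁ d₂) sD vs e with eval ρ D₁ in e₁
  ... | true =
    Derivation-mono (count-left (size D₁) (size D₂))
      (extendʳᵈ (true-disjunctionᵈ d₁ (≤-trans (sizeˡ D₁ D₂) sD) (vs ∘ ⋁ˡ) e₁) (clause-line (disj d₁ d₂) sD))
  ... | false =
    Derivation-mono (count-right (size D₁) (size D₂))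
      (extendˡᵈ (true-disjunctionᵈ d₂ (≤-trans (sizeʳ D₁ D₂) sD) (vs ∘ ⋁ʳ) e) (clause-line (disj d₁ d₂) sD))

  -- Each false disjunct D′ ∈ 𝒞 of D is cut against Γ ∨ D̄′; the resulting copies of Γ
  -- are absorbed by R.
  discharge-falseᵈ : ∀ {F R D k} → R ≈ (R ⋁ Γ) → DisjClosure 𝒞 R → DisjClosure 𝒞 D → size D ≤ s →
                     VarsIn us D → size (R ⋁ D) ≤ L → eval ρ D ≡ false →
                     F ≈ (R ⋁ D) → Derivation F k → Derivation R (k + (2 * size D + 2))
  discharge-falseᵈ {R = R} {D} R≈R⋁Γ cR (base c) sD vs sRD e F≈ dF =
    cutᵈ R Γ D F≈ ≈-refl R≈R⋁Γ dF
      (subst (λ b → Derivation (Γ ⋁ signed b D) (2 * size D + 2)) e (evaluateᵈ D c sD vs))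
      (cR , ≤-trans (sizeˡ R D) sRD)
  discharge-falseᵈ {R = R} {k = k} _ cR empty _ _ sRD _ F≈ dF =
    Derivation-mono (≤-trans (n≤1+n (suc k)) (≤-reflexive (+-comm 2 k)))
      (weakenᵈ 𝟘 (≈-sym (⋁-identityʳ ⟫ F≈ ⟫ ⋁-identityʳ)) dF (cR , ≤-trans (sizeˡ R 𝟘) sRD))
  discharge-falseᵈ {R = R} {D₁ ⋁ D₂} {k} R≈R⋁Γ cR (disj d₁ d₂) sD vs sRD e F≈ dF =
    Derivation-mono (≤-reflexive (count-discharge k (size D₁) (size D₂)))
      (discharge-falseᵈ R≈R⋁Γ cR d₂ (≤-trans (sizeʳ D₁ D₂) sD) (vs ∘ ⋁ʳ) sRD₂ (∨-conicalʳ _ _ e) ≈-refl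
        (discharge-falseᵈ (⋁-absorbs-absorbed R≈R⋁Γ) (disj cR d₂) d₁ (≤-trans (sizeˡ D₁ D₂) sD) (vs ∘ ⋁ˡ)
          (≤-trans (≤-reflexive (reassociate (size R) (size D₁) (size D₂))) sRD) (∨-conicalˡ _ _ e)
          (F≈ ⟫ ⋁-rotate) dF))
    where
    sRD₂ : size (R ⋁ D₂) ≤ L
    sRD₂ = ≤-trans (+-monoˡ-≤ 1 (+-monoʳ-≤ (size R) (sizeʳ D₁ D₂))) sRD
    reassociate : ∀ r a b → r + b + 1 + a + 1 ≡ r + (a + b + 1) + 1
    reassociate = solve-∀

  clause-conclusionᵈ : ∀ {A} → DisjClosure 𝒞 A → size A ≤ s → VarsIn us A →
                       All (DisjClosure 𝒞) Hyp → All (λ B → size B ≤ s) Hyp → All (VarsIn us) Hyp →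
                       Implies Hyp A → Derivation (Γ ⋁ A) (2 * s + 5)
  clause-conclusionᵈ {A} dA sA vA dHyp sHyp vHyp A-follows with eval ρ A in eA
  ... | true =
    Derivation-mono (+-mono-≤ (*-monoʳ-≤ 2 sA) (s≤s (s≤s z≤n))) (true-disjunctionᵈ dA sA vA eA)
  ... | false with find (¬All⇒Any¬ (λ B → eval ρ B ≟ᵇ true) Hyp
                          λ all-true → contradiction (trans (sym eA) (A-follows ρ all-true)) λ ())
  ... | B , B∈Hyp , B-false =
    Derivation-mono (count-hypothesis sB)
      (discharge-falseᵈ (≈-sym (⋁-comm ⟫ ⋁-contract)) (disj Γ-closed dA) dB sB (All.lookup vHyp B∈Hyp)
        line-size (¬-not B-false) ≈-refl
        (weakenᵈ (Γ ⋁ A) ⋁-comm (hypᵈ B∈Hyp (dB , ≤-trans sB s≤L)) (disj (disj Γ-closed dA) dB , line-size)))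
    where
    dB : DisjClosure 𝒞 B
    dB = All.lookup dHyp B∈Hyp
    sB : size B ≤ s
    sB = All.lookup sHyp B∈Hyp
    s≤L : s ≤ L
    s≤L = ≤-trans (≤-trans (m≤n+m s (size Γ)) (m≤m+n _ 1)) room′
    line-size : size ((Γ ⋁ A) ⋁ B) ≤ L
    line-size = ≤-trans (+-monoˡ-≤ 1 (+-mono-≤ (+-monoˡ-≤ 1 (+-monoʳ-≤ (size Γ) sA)) sB))
                  (≤-trans (≤-reflexive (regroup (size Γ) s)) room)
      where
      regroup : ∀ g s → g + s + 1 + s + 1 ≡ g + 2 * s + 2
      regroup = solve-∀
    count-hypothesis : ∀ {b} → b ≤ s → 3 + (2 * b + 2) ≤ 2 * s + 5
    count-hypothesis {b} b≤s = ≤-trans (≤-reflexive (regroup b)) (+-monoˡ-≤ 5 (*-monoʳ-≤ 2 b≤s))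
      where
      regroup : ∀ b → 3 + (2 * b + 2) ≡ 2 * b + 5
      regroup = solve-∀

module Elimination {n : ℕ} {𝒞 : Formula n → Set} (Hyp : List (Formula n)) (L m : ℕ)
  {A : Formula n} (dA : DisjClosure 𝒞 A) (fits : 2 * m + size A + 1 ≤ L) where

  open Derivations (Admissible (DisjClosure 𝒞) L) Hyp

  resolve-variableᵈ : ∀ {k} x us → All (x ≢_) us → All (LiteralsIn 𝒞) us → length us ≤ m →
                      (∀ ρ → Derivation (clause ρ (x ∷ us) ⋁ A) k) →
                      ∀ ρ → Derivation (clause ρ us ⋁ A) (k + k)
  resolve-variableᵈ {k} x us x∉us us-lits us≤m d ρ =
    resolveᵈ rearrange rearrange (fixing true) (fixing false) (disj (clause-closed ρ us-lits) dA , line-size)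
    where
    fixing : ∀ b → Derivation ((comp (signed b (pos x)) ⋁ clause ρ us) ⋁ A) k
    fixing b = subst (λ C → Derivation (C ⋁ A) k) (clause-updateAt ρ x b us x∉us) (d (updateAt ρ x (const b)))
    rearrange : ∀ {ℓ C} → ((ℓ ⋁ C) ⋁ A) ≈ ((C ⋁ A) ⋁ ℓ)
    rearrange = ⋁-assoc ⟫ ⋁-comm
    line-size : size (clause ρ us ⋁ A) ≤ L
    line-size = ≤-trans (+-monoˡ-≤ 1 (+-monoˡ-≤ (size A)
                  (≤-trans (≤-reflexive (size-clause ρ us)) (*-monoʳ-≤ 2 us≤m)))) fits

  eliminateᵈ : ∀ {k} us → Unique us → All (LiteralsIn 𝒞) us → length us ≤ m →
               (∀ ρ → Derivation (clause ρ us ⋁ A) k) → Derivation (𝟘 ⋁ A) (2 ^ length us * k)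
  eliminateᵈ {k} [] _ _ _ d = Derivation-mono (≤-reflexive (sym (*-identityˡ k))) (d (const false))
  eliminateᵈ {k} (x ∷ us) (x∉us ∷ unique) (_ ∷ us-lits) x∷us≤m d =
    Derivation-mono (≤-reflexive (doubling (2 ^ length us) k))
      (eliminateᵈ us unique us-lits us≤m (resolve-variableᵈ x us x∉us us-lits us≤m d))
    where
    us≤m : length us ≤ m
    us≤m = ≤-trans (n≤1+n (length us)) x∷us≤m
    doubling : ∀ p k → p * (k + k) ≡ 2 * p * k
    doubling = solve-∀

affine≤ : ∀ {a b} x → a ≤ b → a * x + b ≤ b * suc x
affine≤ {a} {b} x a≤b =
  ≤-trans (+-monoˡ-≤ b (*-monoˡ-≤ x a≤b)) (≤-reflexive (trans (+-comm (b * x) b) (sym (*-suc b x))))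

size-bound : ∀ n s m {v} → v ≤ n →
             2 ^ v * (2 * s + 5) * (2 * n + 2 * s + 3) ≤ 15 * suc (n + s + m + 2 ^ n + s ^ m) ^ 3
size-bound n s m {v} v≤n = begin
    2 ^ v * (2 * s + 5) * (2 * n + 2 * s + 3)
  ≤⟨ *-mono-≤ (*-mono-≤ 2^v≤N lines≤5N) width≤3N ⟩
    N * (5 * N) * (3 * N)
  ≡⟨ cube N ⟩
    15 * N ^ 3
  ∎
  where
  open ≤-Reasoning
  N : ℕ
  N = suc (n + s + m + 2 ^ n + s ^ m)
  n+s<N : suc (n + s) ≤ N
  n+s<N = s≤s (≤-trans (m≤m+n (n + s) m) (≤-trans (m≤m+n _ (2 ^ n)) (m≤m+n _ (s ^ m))))
  2^v≤N : 2 ^ v ≤ N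
  2^v≤N = ≤-trans (^-monoʳ-≤ 2 v≤n)
            (≤-trans (m≤n+m (2 ^ n) (n + s + m)) (≤-trans (m≤m+n _ (s ^ m)) (n≤1+n _)))
  lines≤5N : 2 * s + 5 ≤ 5 * N
  lines≤5N = ≤-trans (affine≤ s (s≤s (s≤s z≤n))) (*-monoʳ-≤ 5 (≤-trans (s≤s (m≤n+m s n)) n+s<N))
  width≤3N : 2 * n + 2 * s + 3 ≤ 3 * N
  width≤3N = ≤-trans (≤-reflexive (cong (_+ 3) (sym (*-distribˡ-+ 2 n s))))
               (≤-trans (affine≤ (n + s) (n≤1+n 2)) (*-monoʳ-≤ 3 n+s<N))
  cube : ∀ N → N * (5 * N) * (3 * N) ≡ 15 * (N * (N * (N * 1)))
  cube = solve-∀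

module Completeness {n : ℕ} {𝒞 : Formula n → Set} (sc : SubformulaClosed 𝒞) (cc : ComplementClosed 𝒞)
  (s : ℕ) (As : List (Formula n)) (A : Formula n)
  (dAs : All (DisjClosure 𝒞) As) (dA : DisjClosure 𝒞 A)
  (sAs : All (λ B → size B ≤ s) As) (sA : size A ≤ s) (A-follows : Implies As A) where

  occurring? : Decidable (λ x → Any (x occursIn_) (A ∷ As))
  occurring? x = any? (occurs? x) (A ∷ As)

  vars : List (Fin n)
  vars = filter occurring? (allFin n)

  vars-unique : Unique vars
  vars-unique = filter⁺ occurring? (allFin⁺ n)

  vars-length : length vars ≤ n
  vars-length = ≤-trans (length-filter occurring? (allFin n)) (≤-reflexive (length-tabulate id))

  vars-literals : All (LiteralsIn 𝒞) vars
  vars-literals = All.tabulate λ x∈vars →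
    uncurry (occurs⇒literalsIn′ sc cc) (lookupAny (dA ∷ dAs) (proj₂ (∈-filter⁻ occurring? {xs = allFin n} x∈vars)))

  A-vars : VarsIn vars A
  A-vars o = ∈-filter⁺ occurring? (∈-allFin _) (here o)

  As-vars : All (VarsIn vars) As
  As-vars = All.tabulate λ B∈As o → ∈-filter⁺ occurring? (∈-allFin _) (there (lose B∈As o))

  L : ℕ
  L = 2 * n + 2 * s + 3

  open Derivations (Admissible (DisjClosure 𝒞) L) As

  leafᵈ : ∀ ρ → Derivation (clause ρ vars ⋁ A) (2 * s + 5)
  leafᵈ ρ =
    Evaluation.clause-conclusionᵈ sc cc As L s (m≤n+m 3 _) ρ vars vars-literals room
      dA sA A-vars dAs sAs As-vars A-follows
    where
    room : size (clause ρ vars) + 2 * s + 2 ≤ L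
    room = subst (λ g → g + 2 * s + 2 ≤ L) (sym (size-clause ρ vars))
             (+-mono-≤ (+-monoˡ-≤ (2 * s) (*-monoʳ-≤ 2 vars-length)) (n≤1+n 2))

  rootᵈ : Derivation A (suc (2 ^ length vars * (2 * s + 5)))
  rootᵈ = weakenᵈ 𝟘 (≈-sym (⋁-identityʳ ⟫ 𝟘⋁))
            (Elimination.eliminateᵈ As L n dA fits vars vars-unique vars-literals vars-length leafᵈ)
            (dA , ≤-trans (≤-trans (m≤n+m (size A) (2 * n)) (m≤m+n _ 1)) fits)
    where
    fits : 2 * n + size A + 1 ≤ L
    fits = +-mono-≤ (+-monoʳ-≤ (2 * n) (≤-trans sA (m≤m+n s (s + 0)))) (s≤s z≤n)

  frege-proof : CFregeProof (DisjClosure 𝒞) As A (15 * suc (n + s + length As + 2 ^ n + s ^ length As) ^ 3)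
  frege-proof = Derivation⇒CFregeProof rootᵈ (size-bound n s (length As) vars-length)

theorem2p1 : Σ ℕ λ c → Σ ℕ λ k →
    (n : ℕ) (𝒞 : Formula n → Set) → SubformulaClosed 𝒞 → ComplementClosed 𝒞 →
    (s : ℕ) (As : List (Formula n)) (A : Formula n) →
    All (DisjClosure 𝒞) As → DisjClosure 𝒞 A →
    All (λ B → size B ≤ s) As → size A ≤ s →
    Implies As A →
    CFregeProof (DisjClosure 𝒞) As A
      (c * suc (n + s + length As + 2 ^ n + s ^ length As) ^ k)
theorem2p1 = 15 , 3 , λ n 𝒞 sc cc s As A dAs dA sAs sA A-follows →
  Completeness.frege-proof sc cc s As A dAs dA sAs sA A-follows
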